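{- Let $f,g,h:\{0,1\}^n\to\{0,1\}$ be Boolean functions with $f=g.h$ and $h\neq 1$. Then for any $P\in\mathcal{P}_{g,h}$, $f$ is satisfiable if and only if $\zeta[h,g,P]$ is satisfiable. Moreover, for any such $P$, the solution sets coincide: $\{z: f(z)=1\}=\{z:\zeta[h,g,P](z)=1\}$.
   Context: Boolean functions are maps $\{0,1\}^n\to\{0,1\}$; $g.h$ is pointwise AND; a Boolean function is satisfiable if it takes the value $1$ at some point. $g_{ON}=\{x:g(x)=1\}$, $g_{OFF}=\{x:g(x)=0\}$. $\mathcal{P}_{g,h}$ is the set of all maps $P:\{0,1\}^n\to\{0,1\}^n$ with $P(x)=x$ for $x\in g_{ON}$ and $P(x)\in h_{OFF}$ for $x\in g_{OFF}$ (nonempty when $h\neq1$). $\zeta[h,g,P]$ denotes the Boolean function $x\mapsto h(P(x))$. -}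

module Defs where

open import Data.Nat using (ℕ)
open import Data.Bool using (Bool; true; false; _∧_)
open import Data.Vec using (Vec)
open import Data.Product using (Σ; _×_)
open import Relation.Binary.PropositionalEquality using (_≡_)
open import Relation.Nullary using (¬_)

Point : ℕ → Set
Point n = Vec Bool n

BoolFn : ℕ → Set
BoolFn n = Point n → Bool

_·_ : ∀ {n} → BoolFn n → BoolFn n → BoolFn n
(g · h) x = g x ∧ h x

one : ∀ {n} → BoolFn n
one _ = true

Satisfiable : ∀ {n} → BoolFn n → Set
Satisfiable {n} f = Σ (Point n) (λ x → f x ≡ true)

In𝒫 : ∀ {n} → BoolFn n → BoolFn n → (Point n → Point n) → Set
In𝒫 g h P = (∀ x → g x ≡ true → P x ≡ x) × (∀ x → g x ≡ false → h (P x) ≡ false)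

ζ : ∀ {n} → BoolFn n → BoolFn n → (Point n → Point n) → BoolFn n
ζ h g P x = h (P x)

-- On g_ON the map P fixes x, so h (P x) = h x = (g · h) x; on g_OFF it sends x into
-- h_OFF, so h (P x) = false = (g · h) x.  Hence f and ζ[h,g,P] are the same function.
module Submission where

open import Defs
open import Data.Nat using (ℕ)
open import Data.Bool using (true; false)
open import Data.Product using (_×_; _,_)
open import Function.Bundles using (_⇔_; mk⇔)
open import Relation.Binary.PropositionalEquality
  using (_≡_; _≗_; sym; trans; cong)
open import Relation.Nullary using (¬_)

·≗ζ : ∀ {n} (g h : BoolFn n) (P : Point n → Point n) → In𝒫 g h P →
      g · h ≗ ζ h g P
·≗ζ g h P (fixes-ON , lands-OFF) x with g x in gx≡
... | true  = sym (cong h (fixes-ON x gx≡))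
... | false = sym (lands-OFF x gx≡)

satisfiable-resp-≗ : ∀ {n} {f f′ : BoolFn n} → f ≗ f′ →
                     Satisfiable f ⇔ Satisfiable f′
satisfiable-resp-≗ f≗f′ =
  mk⇔ (λ (x , fx) → x , trans (sym (f≗f′ x)) fx)
      (λ (x , f′x) → x , trans (f≗f′ x) f′x)

on-resp-≗ : ∀ {n} {f f′ : BoolFn n} → f ≗ f′ →
            ∀ z → (f z ≡ true) ⇔ (f′ z ≡ true)
on-resp-≗ f≗f′ z = mk⇔ (trans (sym (f≗f′ z))) (trans (f≗f′ z))

-- The hypothesis h ≠ 1 only guarantees that 𝒫_{g,h} is nonempty.
theorem2 : {n : ℕ} (f g h : BoolFn n) →
    (∀ x → f x ≡ (g · h) x) →
    ¬ (∀ x → h x ≡ one x) →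
    (P : Point n → Point n) → In𝒫 g h P →
    (Satisfiable f ⇔ Satisfiable (ζ h g P))
      × (∀ z → (f z ≡ true) ⇔ (ζ h g P z ≡ true))
theorem2 f g h f≡g·h _ P P∈𝒫 = satisfiable-resp-≗ f≗ζ , on-resp-≗ f≗ζ
  where
  f≗ζ : f ≗ ζ h g P
  f≗ζ x = trans (f≡g·h x) (·≗ζ g h P P∈𝒫 x)
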